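{- In an edge iterated graph system, for any path matrix $\mathbf D\in\mathcal D$, every primitive block of $\mathbf D$ is contained in a unique primitive block of $\mathbf M$. In particular, $\mathfrak h_{\mathbf D}\ge\mathfrak h_{\mathbf M}$.
   Context: EIGS: $K\ge1$ colours; for $i\in[K]$, $R_i$ is a finite connected directed graph with edges coloured in $[K]$ and two planting vertices $\beta_i^+,\beta_i^-$. Mass matrix $\mathbf M\in\mathbb N^{K\times K}$: $[\mathbf M]_{ik}$ = number of colour-$k$ edges of $R_i$. Path matrices: for each $i$ choose a simple path (no repeated vertices) from $\beta_i^+$ to $\beta_i^-$ in the underlying undirected graph of $R_i$; the matrix whose $i$-th row has $k$-th entry equal to the number of colour-$k$ edges on the chosen path is a path matrix; $\mathcal D$ is the set of all path matrices. Frobenius notions: for a nonnegative $\mathbf X\in\mathbb R^{K\times K}$, the blocks $\mathfrak B_1,\dots,\mathfrak B_{\mathfrak h_{\mathbf X}}$ are the classes of the equivalence relation of mutual reachability ($i$ reaches $k$ iff $[\mathbf X^n]_{ik}>0$ for some $n\ge0$), i.e. the index sets of the diagonal blocks in the Frobenius normal form; $\mathfrak h_{\mathbf X}$ is their number. Standing assumption: all matrices considered are primitive-Frobenius (every diagonal block is primitive), and the blocks are then called primitive blocks. -}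

module Defs where

open import Data.Nat using (ℕ; zero; suc; _+_; _*_; _<_; _≤_)
open import Data.Fin using (Fin; zero; suc; fromℕ; inject₁; _≟_)
open import Data.Bool using (if_then_else_)
open import Data.Product using (Σ; ∃; _×_)
open import Data.Sum using (_⊎_)
open import Relation.Nullary.Decidable using (⌊_⌋)
open import Relation.Binary.PropositionalEquality using (_≡_)
open import Function.Definitions using (Injective)

sumFin : (n : ℕ) → (Fin n → ℕ) → ℕ
sumFin zero    f = 0
sumFin (suc n) f = f zero + sumFin n (λ j → f (suc j))

[_≡ᶜ_] : ∀ {K} → Fin K → Fin K → ℕ
[ c ≡ᶜ k ] = if ⌊ c ≟ k ⌋ then 1 else 0

record Graph (K : ℕ) : Set where
  field
    V   : ℕ
    E   : ℕ
    src : Fin E → Fin V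
    tgt : Fin E → Fin V
    col : Fin E → Fin K

module _ {K : ℕ} (G : Graph K) where
  open Graph G

  data UWalk : Fin V → Fin V → Set where
    here : ∀ v → UWalk v v
    fwd  : ∀ e {w} → UWalk (tgt e) w → UWalk (src e) w
    bwd  : ∀ e {w} → UWalk (src e) w → UWalk (tgt e) w

  Connected : Set
  Connected = ∀ u v → UWalk u v

  -- simple path (no repeated vertices) from a to b in the underlying
  -- undirected graph: vertices v_0..v_len, edges e_1..e_len
  record SimplePath (a b : Fin V) : Set where
    field
      len   : ℕ
      vert  : Fin (suc len) → Fin V
      edge  : Fin len → Fin E
      start : vert zero ≡ a
      end   : vert (fromℕ len) ≡ b
      inj   : Injective _≡_ _≡_ vert
      link  : ∀ j →
        (src (edge j) ≡ vert (inject₁ j) × tgt (edge j) ≡ vert (suc j))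
        ⊎ (src (edge j) ≡ vert (suc j) × tgt (edge j) ≡ vert (inject₁ j))

  edgesOfColour : Fin K → ℕ
  edgesOfColour k = sumFin E (λ e → [ col e ≡ᶜ k ])

  pathEdgesOfColour : ∀ {a b} → SimplePath a b → Fin K → ℕ
  pathEdgesOfColour p k = sumFin (SimplePath.len p) (λ j → [ col (SimplePath.edge p j) ≡ᶜ k ])

record EIGS (K : ℕ) : Set where
  field
    R    : Fin K → Graph K
    β⁺   : (i : Fin K) → Fin (Graph.V (R i))
    β⁻   : (i : Fin K) → Fin (Graph.V (R i))
    conn : (i : Fin K) → Connected (R i)

Mat : ℕ → Set
Mat K = Fin K → Fin K → ℕ

massMatrix : ∀ {K} → EIGS K → Mat K
massMatrix S i k = edgesOfColour (EIGS.R S i) k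

IsPathMatrix : ∀ {K} → EIGS K → Mat K → Set
IsPathMatrix {K} S D =
  Σ ((i : Fin K) → SimplePath (EIGS.R S i) (EIGS.β⁺ S i) (EIGS.β⁻ S i)) λ p →
    ∀ i k → D i k ≡ pathEdgesOfColour (EIGS.R S i) (p i) k

idMat : ∀ {K} → Mat K
idMat i j = if ⌊ i ≟ j ⌋ then 1 else 0

_⊗_ : ∀ {K} → Mat K → Mat K → Mat K
_⊗_ {K} X Y i j = sumFin K (λ l → X i l * Y l j)

matPow : ∀ {K} → Mat K → ℕ → Mat K
matPow X zero    = idMat
matPow X (suc n) = X ⊗ matPow X n

Reaches : ∀ {K} → Mat K → Fin K → Fin K → Set
Reaches X i k = ∃ λ n → 0 < matPow X n i k

SameBlock : ∀ {K} → Mat K → Fin K → Fin K → Set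
SameBlock X i k = Reaches X i k × Reaches X k i

-- walks of length n along positive entries of X, all vertices satisfying P;
-- positivity of [(X restricted to P)^n]_{jk} unfolded
data WalkIn {K} (X : Mat K) (P : Fin K → Set) : ℕ → Fin K → Fin K → Set where
  stop : ∀ {i} → P i → WalkIn X P zero i i
  step : ∀ {n i j k} → P i → 0 < X i j → WalkIn X P n j k → WalkIn X P (suc n) i k

PrimitiveBlockOf : ∀ {K} → Mat K → Fin K → Set
PrimitiveBlockOf X i =
  ∃ λ n → 1 ≤ n × (∀ j k → SameBlock X i j → SameBlock X i k → WalkIn X (SameBlock X i) n j k)

PrimitiveFrobenius : ∀ {K} → Mat K → Set
PrimitiveFrobenius X = ∀ i → PrimitiveBlockOf X i

HasBlockCount : ∀ {K} → Mat K → ℕ → Set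
HasBlockCount {K} X h =
  Σ (Fin K → Fin h) λ f →
    (∀ b → ∃ λ i → f i ≡ b) ×
    (∀ i j → (f i ≡ f j → SameBlock X i j) × (SameBlock X i j → f i ≡ f j))

-- A simple path in R_i uses only edges of R_i, so every positive entry of a
-- path matrix D is a positive entry of the mass matrix M.  Hence D-reachability
-- implies M-reachability and every block of D lies inside the block of M
-- containing any of its indices; choosing an index in each M-block and sending
-- it to its D-block is then injective, so M has at most as many blocks as D.
module Submission where

open import Defs
open import Data.Nat using (ℕ; zero; suc; _+_; _*_; _<_; _≤_; s≤s; z≤n)
open import Data.Nat.Properties using (≤-trans; m≤m+n; m≤n+m; *-zeroʳ)
open import Data.Fin using (Fin; zero; suc; _≟_)
open import Data.Fin.Properties using (injective⇒≤)
open import Data.Product using (Σ; ∃; _×_; _,_; proj₁; proj₂)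
open import Relation.Nullary using (yes; no; contradiction)
open import Relation.Binary.PropositionalEquality using (_≡_; refl; sym; trans; subst)

private
  variable
    K : ℕ

sumFin-positive⁻ : ∀ n (f : Fin n → ℕ) → 0 < sumFin n f → ∃ λ j → 0 < f j
sumFin-positive⁻ (suc n) f 0<Σ with f zero in eq
... | suc _ = zero , subst (0 <_) (sym eq) (s≤s z≤n)
... | zero with sumFin-positive⁻ n (λ j → f (suc j)) 0<Σ
...   | j , 0<fj = suc j , 0<fj

sumFin-positive⁺ : ∀ n (f : Fin n → ℕ) j → 0 < f j → 0 < sumFin n f
sumFin-positive⁺ (suc n) f zero    0<fj = ≤-trans 0<fj (m≤m+n (f zero) _)
sumFin-positive⁺ (suc n) f (suc j) 0<fj =
  ≤-trans (sumFin-positive⁺ n (λ j → f (suc j)) j 0<fj) (m≤n+m _ (f zero))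

*-positive⁻ : ∀ m n → 0 < m * n → 0 < m × 0 < n
*-positive⁻ (suc m) (suc n) _ = s≤s z≤n , s≤s z≤n
*-positive⁻ (suc m) zero 0<m*0 = contradiction (subst (0 <_) (*-zeroʳ m) 0<m*0) λ ()

*-positive⁺ : ∀ {m n} → 0 < m → 0 < n → 0 < m * n
*-positive⁺ {suc m} {suc n} _ _ = s≤s z≤n

idMat-positive⇒≡ : (i j : Fin K) → 0 < idMat i j → i ≡ j
idMat-positive⇒≡ i j 0<δ with i ≟ j
... | yes i≡j = i≡j

idMat-diagonal-positive : (i : Fin K) → 0 < idMat i i
idMat-diagonal-positive i with i ≟ i
... | yes _  = s≤s z≤n
... | no i≢i = contradiction refl i≢i

⊗-positive⁻ : (X Y : Mat K) → ∀ i k → 0 < (X ⊗ Y) i k →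
  ∃ λ l → 0 < X i l × 0 < Y l k
⊗-positive⁻ {K} X Y i k 0<XY with sumFin-positive⁻ K _ 0<XY
... | l , 0<XY[l] = l , *-positive⁻ (X i l) (Y l k) 0<XY[l]

⊗-positive⁺ : (X Y : Mat K) → ∀ i l k → 0 < X i l → 0 < Y l k → 0 < (X ⊗ Y) i k
⊗-positive⁺ {K} X Y i l k 0<X 0<Y = sumFin-positive⁺ K _ l (*-positive⁺ 0<X 0<Y)

_⊆⁺_ : Mat K → Mat K → Set
X ⊆⁺ Y = ∀ i j → 0 < X i j → 0 < Y i j

matPow-mono : (X Y : Mat K) → X ⊆⁺ Y → ∀ n → matPow X n ⊆⁺ matPow Y n
matPow-mono X Y X⊆Y zero    i k 0<Xⁿ = 0<Xⁿ
matPow-mono X Y X⊆Y (suc n) i k 0<Xⁿ with ⊗-positive⁻ X (matPow X n) i k 0<Xⁿ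
... | l , 0<X , 0<Xⁿ′ =
  ⊗-positive⁺ Y (matPow Y n) i l k (X⊆Y i l 0<X) (matPow-mono X Y X⊆Y n l k 0<Xⁿ′)

matPow-+-positive : (X : Mat K) → ∀ m n i j k →
  0 < matPow X m i j → 0 < matPow X n j k → 0 < matPow X (m + n) i k
matPow-+-positive X zero n i j k 0<δ 0<Xⁿ with idMat-positive⇒≡ i j 0<δ
... | refl = 0<Xⁿ
matPow-+-positive X (suc m) n i j k 0<Xᵐ 0<Xⁿ with ⊗-positive⁻ X (matPow X m) i j 0<Xᵐ
... | l , 0<X , 0<Xᵐ′ =
  ⊗-positive⁺ X (matPow X (m + n)) i l k 0<X (matPow-+-positive X m n l j k 0<Xᵐ′ 0<Xⁿ)

Reaches-trans : (X : Mat K) → ∀ {i j k} → Reaches X i j → Reaches X j k → Reaches X i k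
Reaches-trans X (m , 0<Xᵐ) (n , 0<Xⁿ) = m + n , matPow-+-positive X m n _ _ _ 0<Xᵐ 0<Xⁿ

Reaches-mono : (X Y : Mat K) → X ⊆⁺ Y → ∀ {i k} → Reaches X i k → Reaches Y i k
Reaches-mono X Y X⊆Y (n , 0<Xⁿ) = n , matPow-mono X Y X⊆Y n _ _ 0<Xⁿ

SameBlock-refl : (X : Mat K) → ∀ i → SameBlock X i i
SameBlock-refl X i = (0 , idMat-diagonal-positive i) , (0 , idMat-diagonal-positive i)

SameBlock-sym : (X : Mat K) → ∀ {i j} → SameBlock X i j → SameBlock X j i
SameBlock-sym X (i→j , j→i) = j→i , i→j

SameBlock-trans : (X : Mat K) → ∀ {i j k} → SameBlock X i j → SameBlock X j k → SameBlock X i k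
SameBlock-trans X (i→j , j→i) (j→k , k→j) = Reaches-trans X i→j j→k , Reaches-trans X k→j j→i

SameBlock-mono : (X Y : Mat K) → X ⊆⁺ Y → ∀ {i k} → SameBlock X i k → SameBlock Y i k
SameBlock-mono X Y X⊆Y (i→k , k→i) = Reaches-mono X Y X⊆Y i→k , Reaches-mono X Y X⊆Y k→i

factorisation⇒≤ : {A : Set} {m n : ℕ} (f : A → Fin m) (g : A → Fin n) →
  (∀ b → ∃ λ a → g a ≡ b) → (∀ a a′ → f a ≡ f a′ → g a ≡ g a′) → n ≤ m
factorisation⇒≤ {A} {m} {n} f g g-onto f≡⇒g≡ = injective⇒≤ f∘section-injective
  where
  section : Fin n → A
  section b = proj₁ (g-onto b)

  f∘section-injective : ∀ {b c} → f (section b) ≡ f (section c) → b ≡ c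
  f∘section-injective {b} {c} f≡ =
    trans (sym (proj₂ (g-onto b))) (trans (f≡⇒g≡ _ _ f≡) (proj₂ (g-onto c)))

HasBlockCount-antimono : (X Y : Mat K) → (∀ {i k} → SameBlock X i k → SameBlock Y i k) →
  ∀ {hX hY} → HasBlockCount X hX → HasBlockCount Y hY → hY ≤ hX
HasBlockCount-antimono X Y X⇒Y (fX , _ , blocksX) (fY , fY-onto , blocksY) =
  factorisation⇒≤ fX fY fY-onto
    (λ i j fXi≡fXj → proj₂ (blocksY i j) (X⇒Y (proj₁ (blocksX i j) fXi≡fXj)))

pathMatrix⊆⁺massMatrix : (S : EIGS K) (D : Mat K) → IsPathMatrix S D → D ⊆⁺ massMatrix S
pathMatrix⊆⁺massMatrix S D (p , D≡) i k 0<D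
  with sumFin-positive⁻ _ _ (subst (0 <_) (D≡ i k) 0<D)
... | j , colour-k = sumFin-positive⁺ _ _ (SimplePath.edge (p i) j) colour-k

proposition2p13 : ∀ {K : ℕ} → 1 ≤ K → (S : EIGS K) → (D : Mat K) →
    IsPathMatrix S D →
    PrimitiveFrobenius (massMatrix S) → PrimitiveFrobenius D →
    (∀ (i : Fin K) → Σ (Fin K) λ j →
        (∀ k → SameBlock D i k → SameBlock (massMatrix S) j k) ×
        (∀ j′ → (∀ k → SameBlock D i k → SameBlock (massMatrix S) j′ k) →
          ∀ k → (SameBlock (massMatrix S) j k → SameBlock (massMatrix S) j′ k) ×
                (SameBlock (massMatrix S) j′ k → SameBlock (massMatrix S) j k)))
    × (∀ hD hM → HasBlockCount D hD → HasBlockCount (massMatrix S) hM → hM ≤ hD)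
proposition2p13 _ S D isPath _ _ = blockOfM , λ _ _ → HasBlockCount-antimono D M D⇒M
  where
  M = massMatrix S

  D⇒M : ∀ {i k} → SameBlock D i k → SameBlock M i k
  D⇒M = SameBlock-mono D M (pathMatrix⊆⁺massMatrix S D isPath)

  blockOfM : ∀ i → Σ (Fin _) λ j →
    (∀ k → SameBlock D i k → SameBlock M j k) ×
    (∀ j′ → (∀ k → SameBlock D i k → SameBlock M j′ k) →
      ∀ k → (SameBlock M j k → SameBlock M j′ k) × (SameBlock M j′ k → SameBlock M j k))
  blockOfM i = i , (λ _ → D⇒M) , λ j′ contains k →
    let j′~i = contains i (SameBlock-refl D i)
    in SameBlock-trans M j′~i , SameBlock-trans M (SameBlock-sym M j′~i)
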